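{- Let $G$ be a partial 2-tree and let $u$ and $v$ be the branch vertices of a $K_{2,3}$-subdivision $H$ in $G$. Then for every optimal tree decomposition $T$ of $G$ without bag duplicates, some bag of $T$ contains both $u$ and $v$.
   Context: A partial 2-tree is a graph of treewidth at most two. A $K_{2,3}$-subdivision is a graph obtained from the complete bipartite graph $K_{2,3}$ by replacing its edges with non-empty, internally pairwise vertex-disjoint paths; its branch vertices are the two vertices of degree 3. A tree decomposition $(\{X_1,\dots,X_r\},T)$ consists of bags $X_i\subseteq V(G)$ arranged in a tree $T$ so that every vertex is in some bag, every edge has both endpoints in some bag, and the bags containing any fixed vertex form a subtree; it is optimal if its maximum bag size minus one equals the treewidth of $G$. "Without bag duplicates" means no two distinct bags of $T$ have the same vertex set. -}

module Defs where

open import Data.Nat using (ℕ; suc; _≤_)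
open import Data.Fin using (Fin; zero; suc)
open import Data.Fin.Subset using (Subset; _∈_; ∣_∣)
open import Data.List using (List; []; _∷_; _++_; length)
open import Data.List.Relation.Unary.Linked using (Linked)
open import Data.List.Relation.Unary.All using (All)
open import Data.List.Relation.Unary.Unique.Propositional using (Unique)
import Data.List.Membership.Propositional as LM
open import Data.Product using (Σ; ∃; ∃-syntax; _×_)
open import Relation.Binary.PropositionalEquality using (_≡_; _≢_)
open import Relation.Nullary using (¬_)

record Graph (n : ℕ) : Set₁ where
  field
    Adj    : Fin n → Fin n → Set
    sym    : ∀ {x y} → Adj x y → Adj y x
    irrefl : ∀ {x} → ¬ Adj x x
open Graph public

Ends : ∀ {n} → Fin n → List (Fin n) → Fin n → Set
Ends x []       y = x ≡ y
Ends x (z ∷ zs) y = Ends z zs y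

Walk : ∀ {n} → Graph n → Fin n → List (Fin n) → Fin n → Set
Walk G x xs y = Linked (Adj G) (x ∷ xs) × Ends x xs y

Connected : ∀ {n} → Graph n → Set
Connected G = ∀ x y → ∃[ xs ] Walk G x xs y

-- A cycle: distinct vertices x ∷ xs (at least 3), consecutive adjacent,
-- last adjacent to first.
HasCycle : ∀ {n} → Graph n → Set
HasCycle G = ∃[ x ] ∃[ xs ] ∃[ y ]
  (2 ≤ length xs × Unique (x ∷ xs) × Walk G x xs y × Adj G y x)

IsTree : ∀ {n} → Graph n → Set
IsTree G = Connected G × ¬ HasCycle G

record TreeDecomposition {n : ℕ} (G : Graph n) : Set₁ where
  field
    r       : ℕ
    T       : Graph (suc r)
    isTree  : IsTree T
    bag     : Fin (suc r) → Subset n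
    covers  : ∀ x → ∃[ i ] (x ∈ bag i)
    edgeCov : ∀ x y → Adj G x y → ∃[ i ] (x ∈ bag i × y ∈ bag i)
    subtree : ∀ x i j → x ∈ bag i → x ∈ bag j →
              ∃[ ks ] (Walk T i ks j × All (λ k → x ∈ bag k) ks)
open TreeDecomposition public

-- All bags have at most m vertices (i.e. width ≤ m - 1).
BagsAtMost : ∀ {n} {G : Graph n} → TreeDecomposition G → ℕ → Set
BagsAtMost D m = ∀ i → ∣ bag D i ∣ ≤ m

-- Optimal: width equals treewidth, i.e. its maximum bag size is
-- at most that of any other tree decomposition of G.
Optimal : ∀ {n} {G : Graph n} → TreeDecomposition G → Set₁
Optimal {G = G} D = ∀ (D' : TreeDecomposition G) m → BagsAtMost D' m → BagsAtMost D m

NoBagDuplicates : ∀ {n} {G : Graph n} → TreeDecomposition G → Set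
NoBagDuplicates D = ∀ i j → bag D i ≡ bag D j → i ≡ j

Partial2Tree : ∀ {n} → Graph n → Set₁
Partial2Tree G = ∃[ D ] BagsAtMost {G = G} D 3

-- K_{2,3} has parts {b 0, b 1} (the branch
-- vertices of degree 3) and {a 0, a 1, a 2}; its edges are indexed by
-- (s , i) : Fin 2 × Fin 3, joining b s and a i.  Each edge is replaced by
-- a path  b s ∷ inner s i ++ a i ∷ []  in G (at least one edge).
record K23Subdivision {n : ℕ} (G : Graph n) : Set₁ where
  field
    b     : Fin 2 → Fin n
    a     : Fin 3 → Fin n
    b-inj : b zero ≢ b (suc zero)
    a-inj : ∀ i j → a i ≡ a j → i ≡ j
    ab    : ∀ s i → b s ≢ a i
    inner : Fin 2 → Fin 3 → List (Fin n)
    path  : ∀ s i → Walk G (b s) (inner s i ++ a i ∷ []) (a i)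
    simple : ∀ s i → Unique (b s ∷ inner s i ++ a i ∷ [])
    -- internally pairwise vertex-disjoint: an inner vertex of one path
    -- lies on no other path (hence in particular is no branch vertex)
    disjoint : ∀ s i s' i' → ¬ (s ≡ s' × i ≡ i') → ∀ x →
               x LM.∈ inner s i → ¬ (x LM.∈ (b s' ∷ inner s' i' ++ a i' ∷ []))
open K23Subdivision public

-- Suppose no bag of D contains both branch vertices u and v. Walking in the
-- tree T from a bag of u to a bag of v we leave the bags of u for the last
-- time along an edge st, with u in the bag at s but not at t. The vertices of
-- X = bag s ∩ bag t separate the t-side of T from s: any vertex outside X
-- with one bag beyond t has all its bags there. Each of the three
-- u–v paths of H runs from v (beyond t) to u (in the bag at s), so it meets
-- X, and these three meeting points are distinct. With bags of size at most
-- three this forces bag s = bag t, a duplicate bag.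
module Submission where

open import Defs
open import Data.Nat using (ℕ; suc; _≤_; z≤n; s≤s)
open import Data.Nat.Properties using (≤-trans; <⇒≱)
open import Data.Fin using (Fin; zero; suc; _≟_)
open import Data.Fin.Subset using (Subset; _∈_; _∉_; ∣_∣; _-_; _⊆_)
open import Data.Fin.Subset.Properties
  using (_∈?_; x∈p∧x≢y⇒x∈p-y; x∈p⇒∣p-x∣<∣p∣; ⊆-antisym)
import Data.Fin.Properties as Fin
open import Data.List using (List; []; _∷_; _++_; [_]; length)
open import Data.List.Relation.Unary.Linked using ([-]; _∷_)
open import Data.List.Relation.Unary.All as All using (All; []; _∷_)
open import Data.List.Relation.Unary.All.Properties using (¬Any⇒All¬; ∷ʳ⁺)
import Data.List.Relation.Unary.Any as Any
open import Data.List.Relation.Unary.Any using (here; there)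
open import Data.List.Relation.Unary.AllPairs using ([]; _∷_)
open import Data.List.Relation.Unary.Unique.Propositional using (Unique)
import Data.List.Membership.Propositional as LM
import Data.List.Relation.Binary.Subset.Propositional as LS
open import Data.List.Membership.Propositional.Properties using (∈-++⁻)
open import Data.Product using (Σ; ∃-syntax; _×_; _,_; proj₁; proj₂)
open import Data.Sum using (_⊎_; inj₁; inj₂)
open import Data.Empty using (⊥-elim)
open import Function using (_∘_; id)
open import Relation.Nullary using (¬_; yes; no; contradiction)
open import Relation.Nullary.Decidable using (_×-dec_)
open import Relation.Unary using (Decidable; ∁)
open import Relation.Binary.PropositionalEquality using (_≡_; _≢_; refl; subst; ≢-sym) renaming (sym to ≡-sym)

private
  variable
    n : ℕ
    G : Graph n
    x y z k : Fin n
    xs zs : List (Fin n)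
    p q : Subset n

distinct-members≤∣p∣ : Unique zs → All (_∈ p) zs → length zs ≤ ∣ p ∣
distinct-members≤∣p∣ {zs = []} _ _ = z≤n
distinct-members≤∣p∣ {zs = z ∷ zs} {p} (z∉zs ∷ unique) (z∈p ∷ zs⊆p) =
  ≤-trans (s≤s (distinct-members≤∣p∣ unique zs⊆p-z)) (x∈p⇒∣p-x∣<∣p∣ z∈p)
  where
  zs⊆p-z : All (_∈ p - z) zs
  zs⊆p-z = All.zipWith (λ (w∈p , z≢w) → x∈p∧x≢y⇒x∈p-y w∈p (≢-sym z≢w)) (zs⊆p , z∉zs)

filled-by⇒⊆ : ∣ p ∣ ≤ length zs → Unique zs → All (_∈ p) zs → All (_∈ q) zs → p ⊆ q
filled-by⇒⊆ {zs = zs} {q = q} ∣p∣≤ unique zs⊆p zs⊆q {w} w∈p with w ∈? q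
... | yes w∈q = w∈q
... | no w∉q = contradiction ∣p∣≤ (<⇒≱ (distinct-members≤∣p∣ (w-fresh ∷ unique) (w∈p ∷ zs⊆p)))
  where
  w-fresh : All (w ≢_) zs
  w-fresh = All.map (λ { z∈q refl → w∉q z∈q }) zs⊆q

Path : Graph n → Fin n → List (Fin n) → Fin n → Set
Path G x xs y = Walk G x xs y × Unique (x ∷ xs)

ends-∈ : Ends x xs y → y LM.∈ x ∷ xs
ends-∈ {xs = []} refl = here refl
ends-∈ {xs = _ ∷ _} e = there (ends-∈ e)

LastExit : Graph n → (Fin n → Set) → Fin n → Set
LastExit G Q y = ∃[ s ] ∃[ t ] ∃[ ts ] (Adj G s t × Q s × Walk G t ts y × All (∁ Q) (t ∷ ts))

module _ (G : Graph n) where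

  walk-snoc : Walk G x xs y → Adj G y k → Walk G x (xs ++ [ k ]) k
  walk-snoc {xs = []} (_ , refl) yk = yk ∷ [-] , refl
  walk-snoc {xs = _ ∷ _} (xz ∷ linked , ends) yk =
    let linked′ , ends′ = walk-snoc (linked , ends) yk in xz ∷ linked′ , ends′

  path-suffix : z LM.∈ x ∷ xs → Path G x xs y → ∃[ zs ] (Path G z zs y × zs LS.⊆ xs)
  path-suffix (here refl) path = _ , path , id
  path-suffix {xs = _ ∷ _} (there z∈) ((_ ∷ linked , ends) , _ ∷ unique) =
    let zs , path , zs⊆ = path-suffix z∈ ((linked , ends) , unique) in zs , path , there ∘ zs⊆

  -- Cut the walk at the last visit of its start vertex, recursively.
  walk⇒path : Walk G x xs y → ∃[ ys ] (Path G x ys y × ys LS.⊆ xs)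
  walk⇒path {xs = []} walk = [] , (walk , [] ∷ []) , id
  walk⇒path {x = x} {xs = z ∷ zs} (xz ∷ linked , ends) with walk⇒path (linked , ends)
  ... | ys , path@((linked′ , ends′) , unique) , ys⊆zs with Any.any? (x ≟_) (z ∷ ys)
  ...   | yes x∈ = let ws , path′ , ws⊆ys = path-suffix x∈ path in ws , path′ , there ∘ ys⊆zs ∘ ws⊆ys
  ...   | no x∉ = z ∷ ys , ((xz ∷ linked′ , ends′) , ¬Any⇒All¬ _ x∉ ∷ unique) , λ
    { (here refl) → here refl ; (there w∈) → there (ys⊆zs w∈) }

  module _ {Q : Fin n → Set} (Q? : Decidable Q) where

    walk-avoids⊎last-exit : ¬ Q y → Walk G x xs y → All (∁ Q) (x ∷ xs) ⊎ LastExit G Q y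
    walk-avoids⊎last-exit {xs = []} ¬Qy (_ , refl) = inj₁ (¬Qy ∷ [])
    walk-avoids⊎last-exit {x = x} {xs = z ∷ zs} ¬Qy (xz ∷ linked , ends)
      with walk-avoids⊎last-exit ¬Qy (linked , ends)
    ... | inj₂ exit = inj₂ exit
    ... | inj₁ avoids with Q? x
    ...   | yes Qx = inj₂ (x , z , zs , xz , Qx , (linked , ends) , avoids)
    ...   | no ¬Qx = inj₁ (¬Qx ∷ avoids)

    last-exit : Q x → ¬ Q y → Walk G x xs y → LastExit G Q y
    last-exit Qx ¬Qy walk with walk-avoids⊎last-exit ¬Qy walk
    ... | inj₁ (¬Qx ∷ _) = contradiction Qx ¬Qx
    ... | inj₂ exit = exit

module EdgeSide {m : ℕ} (T : Graph m) (acyclic : ¬ HasCycle T)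
                {s t : Fin m} (st : Adj T s t) where

  Side : Fin m → Set
  Side a = ∃[ ts ] (Walk T t ts a × All (_≢ s) (t ∷ ts))

  s∉Side : ¬ Side s
  s∉Side (_ , (_ , ends) , avoids) = All.lookup avoids (ends-∈ ends) refl

  -- Otherwise s, t, …, a would be a cycle.
  Side-¬Adj-s : ∀ {a} → Side a → a ≢ t → ¬ Adj T a s
  Side-¬Adj-s (_ , walk , avoids) a≢t as with walk⇒path T walk
  ... | [] , ((_ , refl) , _) , _ = a≢t refl
  ... | y ∷ ys , ((linked , ends) , unique) , ys⊆ts =
    acyclic (s , t ∷ y ∷ ys , _ , s≤s (s≤s z≤n) , s-fresh ∷ unique , (st ∷ linked , ends) , as)
    where
    s-fresh : All (s ≢_) (t ∷ y ∷ ys)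
    s-fresh = All.tabulate λ
      { (here refl) → ≢-sym (All.lookup avoids (here refl))
      ; (there w∈) → ≢-sym (All.lookup avoids (there (ys⊆ts w∈))) }

  Side-step : ∀ {a b} → Side a → Adj T a b → Side b ⊎ (a ≡ t × b ≡ s)
  Side-step {a} {b} side@(ts , walk , avoids) ab with b ≟ s | a ≟ t
  ... | no b≢s | _ = inj₁ (ts ++ [ b ] , walk-snoc T walk ab , ∷ʳ⁺ avoids b≢s)
  ... | yes refl | yes refl = inj₂ (refl , refl)
  ... | yes refl | no a≢t = ⊥-elim (Side-¬Adj-s side a≢t ab)

module Separation (D : TreeDecomposition G) {s t : Fin (suc (r D))} (st : Adj (T D) s t) where
  open EdgeSide (T D) (proj₂ (isTree D)) st public

  InSeparator : Fin _ → Set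
  InSeparator x = x ∈ bag D s × x ∈ bag D t

  InSeparator? : Decidable InSeparator
  InSeparator? x = (x ∈? bag D s) ×-dec (x ∈? bag D t)

  Confined : Fin _ → Set
  Confined x = ∀ a → x ∈ bag D a → Side a

  Side-along-bags : ∀ {a as b} → ¬ InSeparator x → x ∈ bag D a → Side a →
                    Walk (T D) a as b → All (λ c → x ∈ bag D c) as → Side b
  Side-along-bags {as = []} _ _ side (_ , refl) _ = side
  Side-along-bags {as = _ ∷ _} x∉X x∈a side (ac ∷ linked , ends) (x∈c ∷ x∈as)
    with Side-step side ac
  ... | inj₁ side′ = Side-along-bags x∉X x∈c side′ (linked , ends) x∈as
  ... | inj₂ (refl , refl) = ⊥-elim (x∉X (x∈c , x∈a))

  confined : ∀ {a} → ¬ InSeparator x → x ∈ bag D a → Side a → Confined x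
  confined x∉X x∈a side b x∈b =
    let as , walk , x∈as = subtree D _ _ b x∈a x∈b in Side-along-bags x∉X x∈a side walk x∈as

  confined-edge : Adj G x y → ¬ InSeparator x → Confined y → Confined x
  confined-edge {x = x} {y} xy x∉X y-confined =
    let a , x∈a , y∈a = edgeCov D x y xy in confined x∉X x∈a (y-confined a y∈a)

  confined-forward : Walk G x xs y → All (∁ InSeparator) xs → Confined x → Confined y
  confined-forward {xs = []} (_ , refl) _ = id
  confined-forward {xs = _ ∷ _} (xz ∷ linked , ends) (z∉X ∷ avoids) =
    confined-forward (linked , ends) avoids ∘ confined-edge (Graph.sym G xz) z∉X

  confined-backward : Walk G x xs y → All (∁ InSeparator) (x ∷ xs) → Confined y → Confined x
  confined-backward {xs = []} (_ , refl) _ = id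
  confined-backward {xs = _ ∷ _} (xz ∷ linked , ends) (x∉X ∷ avoids) =
    confined-edge xz x∉X ∘ confined-backward (linked , ends) avoids

separating-edge : (D : TreeDecomposition G) → (∀ i → ¬ (x ∈ bag D i × y ∈ bag D i)) →
  ∃[ s ] ∃[ t ] Σ (Adj (T D) s t) λ st →
    x ∈ bag D s × x ∉ bag D t × Separation.Confined D st y
separating-edge {x = x} {y = y} D apart
  with covers D x | covers D y
... | i , x∈i | j , y∈j with proj₁ (isTree D) i j
... | _ , walk with last-exit (T D) (λ a → x ∈? bag D a) x∈i (λ x∈j → apart j (x∈j , y∈j)) walk
... | s , t , ts , st , x∈s , walk′ , x∉ts = s , t , st , x∈s , All.head x∉ts ,
      confined (λ (y∈s , _) → apart s (x∈s , y∈s)) y∈j (ts , walk′ , All.map x∉⇒≢s x∉ts)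
  where
  open Separation D st
  x∉⇒≢s : ∀ {a} → x ∉ bag D a → a ≢ s
  x∉⇒≢s x∉a refl = x∉a x∈s

segment : K23Subdivision G → Fin 2 → Fin 3 → List (Fin _)
segment H σ k = inner H σ k ++ [ a H k ]

segments-disjoint : ∀ (H : K23Subdivision G) {σ σ′ k k′} → k ≢ k′ →
                    z LM.∈ segment H σ k → ¬ z LM.∈ segment H σ′ k′
segments-disjoint H {σ} {σ′} {k} {k′} k≢k′ z∈ z∈′ with ∈-++⁻ (inner H σ k) z∈
... | inj₁ z∈inner = disjoint H σ k σ′ k′ (k≢k′ ∘ proj₂) _ z∈inner (there z∈′)
... | inj₂ (here refl) with ∈-++⁻ (inner H σ′ k′) z∈′
...   | inj₁ z∈inner′ = disjoint H σ′ k′ σ k (k≢k′ ∘ ≡-sym ∘ proj₂) _ z∈inner′ (there z∈)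
...   | inj₂ (here a≡a′) = k≢k′ (a-inj H k k′ a≡a′)

module _ (H : K23Subdivision G) (D : TreeDecomposition G)
         {s t : Fin (suc (r D))} (st : Adj (T D) s t) where
  open Separation D st

  private
    u v : Fin _
    u = b H zero
    v = b H (suc zero)

  segment-meets-separator : u ∈ bag D s → u ∉ bag D t → Confined v →
    ∀ k → ∃[ σ ] ∃[ z ] (z LM.∈ segment H σ k × InSeparator z)
  segment-meets-separator u∈s u∉t v-confined k
    with Any.any? InSeparator? (segment H zero k) | Any.any? InSeparator? (segment H (suc zero) k)
  ... | yes meets | _ = zero , LM.find meets
  ... | no _ | yes meets = suc zero , LM.find meets
  ... | no avoids₀ | no avoids₁ = ⊥-elim (s∉Side (u-confined s u∈s))
    where
    a-confined : Confined (a H k)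
    a-confined = confined-forward (path H (suc zero) k) (¬Any⇒All¬ _ avoids₁) v-confined
    u-confined : Confined u
    u-confined = confined-backward (path H zero k) (u∉t ∘ proj₂ ∷ ¬Any⇒All¬ _ avoids₀) a-confined

  bag-s≡bag-t : BagsAtMost D 3 →
    (∀ k → ∃[ σ ] ∃[ z ] (z LM.∈ segment H σ k × InSeparator z)) → bag D s ≡ bag D t
  bag-s≡bag-t narrow meet with meet zero | meet (suc zero) | meet (suc (suc zero))
  ... | _ , z₀ , z₀∈ , z₀∈X | _ , z₁ , z₁∈ , z₁∈X | _ , z₂ , z₂∈ , z₂∈X =
    ⊆-antisym (filled-by⇒⊆ (narrow s) distinct (All.map proj₁ in-X) (All.map proj₂ in-X))
              (filled-by⇒⊆ (narrow t) distinct (All.map proj₂ in-X) (All.map proj₁ in-X))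
    where
    apart : ∀ {σ σ′ k k′ z z′} → k ≢ k′ →
            z LM.∈ segment H σ k → z′ LM.∈ segment H σ′ k′ → z ≢ z′
    apart k≢k′ z∈ z′∈ refl = segments-disjoint H k≢k′ z∈ z′∈
    distinct : Unique (z₀ ∷ z₁ ∷ z₂ ∷ [])
    distinct = (apart (λ ()) z₀∈ z₁∈ ∷ apart (λ ()) z₀∈ z₂∈ ∷ [])
             ∷ (apart (λ ()) z₁∈ z₂∈ ∷ []) ∷ [] ∷ []
    in-X : All InSeparator (z₀ ∷ z₁ ∷ z₂ ∷ [])
    in-X = z₀∈X ∷ z₁∈X ∷ z₂∈X ∷ []

lemma8 : ∀ {n} (G : Graph n) → Partial2Tree G → (H : K23Subdivision G) →
         (D : TreeDecomposition G) → Optimal D → NoBagDuplicates D →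
         ∃[ i ] (b H zero ∈ bag D i × b H (suc zero) ∈ bag D i)
lemma8 G (D′ , narrow′) H D optimal no-duplicates
  with Fin.any? (λ i → (b H zero ∈? bag D i) ×-dec (b H (suc zero) ∈? bag D i))
... | yes shared = shared
... | no none with separating-edge D (λ i both → none (i , both))
...   | s , t , st , u∈s , u∉t , v-confined =
  ⊥-elim (Graph.irrefl (T D) (subst (Adj (T D) s) (≡-sym s≡t) st))
  where
  s≡t : s ≡ t
  s≡t = no-duplicates s t (bag-s≡bag-t H D st (optimal D′ 3 narrow′)
                             (segment-meets-separator H D st u∈s u∉t v-confined))
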